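{- Let $(X,\le,Q,D,\top,\tau)$ be a Sugihara space. Then $(X,\le,D,\top,\tau)$ is a bRS-space.
   Context: A Priestley space $(X,\le,\tau)$ is a compact space with a partial order such that $x\not\le y$ implies some clopen up-set contains $x$ but not $y$; it is Esakia if $\downarrow U$ is clopen for every clopen $U$; pointed if it has a greatest element $\top$. A pointed Kleene space is $(X,\le,Q,D,\top,\tau)$ with $(X,\le,\top,\tau)$ a pointed Priestley space, $Q$ a closed binary relation, $D$ closed, and for all $x,y,z$: $xQx$; ($xQy$ and $x\in D$) implies $x\le y$; ($xQy$ and $y\le z$) implies $zQx$. A Sugihara space is a pointed Kleene space with $(X,\le,\top,\tau)$ pointed Esakia, $Q=\le\cup\ge$, and $D$ open. A bRS-space is $(X,\le,D,\top,\tau)$ with $(X,\le,\top,\tau)$ a pointed Esakia space, $(X,\le)$ a forest (${\uparrow}x$ is a chain for each $x$), and $D$ a clopen set of $\le$-minimal elements. -}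

module Defs where

open import Level using (0ℓ)
open import Data.Unit using (⊤)
open import Data.Product using (Σ; ∃; _×_; _,_)
open import Data.Sum using (_⊎_)
open import Data.List using (List)
open import Data.List.Relation.Unary.Any using (Any)
open import Relation.Nullary using (¬_)
open import Relation.Unary using (Pred; _∈_; _∉_; _∩_; ∁; _⊆_)
open import Relation.Binary using (Rel; IsPartialOrder)
open import Relation.Binary.PropositionalEquality using (_≡_)

record Topology (X : Set) : Set₁ where
  field
    Open     : Pred X 0ℓ → Set
    -- opens are determined extensionally (subsets, not predicates)
    open-ext : ∀ {A B : Pred X 0ℓ} → A ⊆ B → B ⊆ A → Open A → Open B
    open-univ : Open (λ _ → ⊤)
    open-∩   : ∀ {A B : Pred X 0ℓ} → Open A → Open B → Open (A ∩ B)
    open-⋃   : (I : Set) (F : I → Pred X 0ℓ) → (∀ i → Open (F i)) →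
               Open (λ x → ∃ λ i → x ∈ F i)

module _ {X : Set} (τ : Topology X) where
  open Topology τ

  Closed : Pred X 0ℓ → Set
  Closed A = Open (∁ A)

  Clopen : Pred X 0ℓ → Set
  Clopen A = Open A × Closed A

  Compact : Set₁
  Compact = (I : Set) (F : I → Pred X 0ℓ) → (∀ i → Open (F i)) →
            (∀ x → ∃ λ i → x ∈ F i) →
            Σ (List I) λ is → ∀ x → Any (λ i → x ∈ F i) is

  -- closed in the product topology on X × X: the complement is open, i.e.
  -- a union of open rectangles
  ClosedRel : Rel X 0ℓ → Set₁
  ClosedRel R = ∀ x y → ¬ R x y →
    Σ (Pred X 0ℓ) λ U → Σ (Pred X 0ℓ) λ V →
      Open U × Open V × x ∈ U × y ∈ V ×
      (∀ u v → u ∈ U → v ∈ V → ¬ R u v)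

module _ {X : Set} (_≤_ : Rel X 0ℓ) where

  UpSet : Pred X 0ℓ → Set
  UpSet U = ∀ {x y} → x ∈ U → x ≤ y → y ∈ U

  ↓_ : Pred X 0ℓ → Pred X 0ℓ
  ↓ U = λ x → ∃ λ y → x ≤ y × y ∈ U

  Forest : Set
  Forest = ∀ x y z → x ≤ y → x ≤ z → (y ≤ z ⊎ z ≤ y)

  Minimal : Pred X 0ℓ
  Minimal x = ∀ y → y ≤ x → y ≡ x

  IsGreatest : X → Set
  IsGreatest t = ∀ x → x ≤ t

record IsPriestley {X : Set} (τ : Topology X) (_≤_ : Rel X 0ℓ) : Set₁ where
  field
    isPartialOrder : IsPartialOrder _≡_ _≤_
    compact        : Compact τ
    separation     : ∀ x y → ¬ (x ≤ y) →
      Σ (Pred X 0ℓ) λ U → Clopen τ U × UpSet _≤_ U × x ∈ U × y ∉ U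

record IsPointedPriestley {X : Set} (τ : Topology X) (_≤_ : Rel X 0ℓ)
                          (top : X) : Set₁ where
  field
    isPriestley : IsPriestley τ _≤_
    top-greatest : IsGreatest _≤_ top

record IsEsakia {X : Set} (τ : Topology X) (_≤_ : Rel X 0ℓ) : Set₁ where
  field
    isPriestley : IsPriestley τ _≤_
    ↓-clopen    : ∀ U → Clopen τ U → Clopen τ (↓_ _≤_ U)

record IsPointedEsakia {X : Set} (τ : Topology X) (_≤_ : Rel X 0ℓ)
                       (top : X) : Set₁ where
  field
    isEsakia     : IsEsakia τ _≤_
    top-greatest : IsGreatest _≤_ top

record IsPointedKleene {X : Set} (τ : Topology X) (_≤_ : Rel X 0ℓ)
                       (Q : Rel X 0ℓ) (D : Pred X 0ℓ) (top : X) : Set₁ where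
  field
    isPointedPriestley : IsPointedPriestley τ _≤_ top
    Q-closed : ClosedRel τ Q
    D-closed : Closed τ D
    Q-refl   : ∀ x → Q x x
    Q-D      : ∀ x y → Q x y → x ∈ D → x ≤ y
    Q-up     : ∀ x y z → Q x y → y ≤ z → Q z x

record IsSugihara {X : Set} (τ : Topology X) (_≤_ : Rel X 0ℓ)
                  (Q : Rel X 0ℓ) (D : Pred X 0ℓ) (top : X) : Set₁ where
  field
    isPointedKleene : IsPointedKleene τ _≤_ Q D top
    isPointedEsakia : IsPointedEsakia τ _≤_ top
    Q-def₁ : ∀ x y → Q x y → (x ≤ y ⊎ y ≤ x)
    Q-def₂ : ∀ x y → (x ≤ y ⊎ y ≤ x) → Q x y
    D-open : Topology.Open τ D

record IsBRS {X : Set} (τ : Topology X) (_≤_ : Rel X 0ℓ)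
             (D : Pred X 0ℓ) (top : X) : Set₁ where
  field
    isPointedEsakia : IsPointedEsakia τ _≤_ top
    forest     : Forest _≤_
    D-clopen   : Clopen τ D
    D-minimal  : D ⊆ Minimal _≤_

module Submission where

-- Each bRS axiom follows directly:
--   * pointed Esakia: part of the Sugihara data;
--   * forest: if x ≤ y and x ≤ z then y Q x (comparability), so the Kleene
--     axiom (y Q x, x ≤ z ⇒ z Q y) makes z and y comparable;
--   * D clopen: D is closed (Kleene) and open (Sugihara);
--   * D consists of minimal elements: if y ≤ x with x ∈ D then x Q y, so the
--     Kleene axiom (x Q y, x ∈ D ⇒ x ≤ y) and antisymmetry give y = x.

open import Level using (0ℓ)
open import Data.Product using (_,_)
open import Data.Sum using (_⊎_; inj₂; swap)
open import Relation.Unary using (Pred; _∈_; _⊆_)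
open import Relation.Binary using (Rel; Antisymmetric)
open import Relation.Binary.PropositionalEquality using (_≡_)
open import Defs

module _ {X : Set} {_≤_ : Rel X 0ℓ} {Q : Rel X 0ℓ} where

  Q-contains-≥ : Set
  Q-contains-≥ = ∀ x y → y ≤ x → Q x y

  comparability-forest :
    Q-contains-≥ →
    (∀ x y → Q x y → x ≤ y ⊎ y ≤ x) →
    (∀ x y z → Q x y → y ≤ z → Q z x) →
    Forest _≤_
  comparability-forest ≥⊆Q Q⊆comparable Q-up x y z x≤y x≤z =
    swap (Q⊆comparable z y (Q-up y x z (≥⊆Q y x x≤y) x≤z))

  designated-minimal :
    (D : Pred X 0ℓ) →
    Antisymmetric _≡_ _≤_ →
    Q-contains-≥ →
    (∀ x y → Q x y → x ∈ D → x ≤ y) →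
    D ⊆ Minimal _≤_
  designated-minimal D antisym ≥⊆Q Q-D {x} x∈D y y≤x =
    antisym y≤x (Q-D x y (≥⊆Q x y y≤x) x∈D)

mainTheorem14 : {X : Set} (τ : Topology X) (_≤_ : Rel X 0ℓ) (Q : Rel X 0ℓ)
                (D : Pred X 0ℓ) (top : X) →
                IsSugihara τ _≤_ Q D top → IsBRS τ _≤_ D top
mainTheorem14 τ _≤_ Q D top sugihara = record
  { isPointedEsakia = isPointedEsakia
  ; forest          = comparability-forest ≥⊆Q Q-def₁ Q-up
  ; D-clopen        = D-open , D-closed
  ; D-minimal       = designated-minimal D antisym ≥⊆Q Q-D
  }
  where
    open IsSugihara sugihara
    open IsPointedKleene isPointedKleene
    open IsPriestley (IsPointedPriestley.isPriestley isPointedPriestley)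
      using (isPartialOrder)
    open Relation.Binary.IsPartialOrder isPartialOrder using (antisym)

    ≥⊆Q : Q-contains-≥ {_≤_ = _≤_} {Q = Q}
    ≥⊆Q x y y≤x = Q-def₂ x y (inj₂ y≤x)
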